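{- Let $\mathbf{s}=(s_1,\dots,s_n)$ be a sequence of positive integers with $s_1=1$, and $\mathbf{s}^*=(s_1,\dots,s_n,1)$. Then for each $i$, \[\mathcal{L}^i(\operatorname{Par}_{\mathbf{s}^*})=\{\mathbf{x}\in\operatorname{Par}_{\mathbf{s}^*}\cap\mathbb{Z}^{n+1}:\operatorname{asc}_{\mathbf{s}^*}(\overline{\operatorname{REM}}_{\mathbf{s}^*}(\mathbf{x}))=i\}=\{\overline{\operatorname{REM}}_{\mathbf{s}^*}^{ -1}(\mathbf{r}):\operatorname{asc}_{\mathbf{s}^*}(\mathbf{r})=i,\ \mathbf{r}\in\Psi_n\times\langle0\rangle\}=\{\overline{\operatorname{REM}}_{\mathbf{s}^*}^{ -1}(\mathbf{r},0):\operatorname{asc}_{\mathbf{s}}(\mathbf{r})=i,\ \mathbf{r}\in\Psi_n\},\] and \[\ell^i(\operatorname{Par}_{\mathbf{s}^*})=\#\{\mathbf{r}\in\Psi_n\times\langle0\rangle:\operatorname{asc}_{\mathbf{s}^*}(\mathbf{r})=i\}=\#\{\mathbf{r}\in\Psi_n:\operatorname{asc}_{\mathbf{s}}(\mathbf{r})=i\}.\] Hence, with $\pi$ the map dropping the last coordinate, $\pi\circ\overline{\operatorname{REM}}_{\mathbf{s}^*}$ is a bijection from $\operatorname{Par}_{\mathbf{s}^*}\cap\mathbb{Z}^{n+1}$ to $\Psi_n$ such that $\mathbf{x}\in\mathcal{L}^i(\operatorname{Par}_{\mathbf{s}^*})$ if and only if $\operatorname{asc}_{\mathbf{s}}(\p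i(\overline{\operatorname{REM}}_{\mathbf{s}^*}(\mathbf{x})))=i$.
   Context: $\langle N\rangle=\{0,\dots,N\}$, $\Psi_n=\langle s_1-1\rangle\times\cdots\times\langle s_n-1\rangle$. For a sequence $\mathbf{t}=(t_1,\dots,t_m)$ of positive integers, $\operatorname{Par}_{\mathbf{t}}=\{\sum_{j=1}^m c_j\mathbf{w}_j:0\le c_j<1\}\subset\mathbb{R}^m$ with $\mathbf{w}_j=(0,\dots,0,t_j,\dots,t_m)$ ($j-1$ leading zeros), and $\overline{\operatorname{REM}}_{\mathbf{t}}:\operatorname{Par}_{\mathbf{t}}\cap\mathbb{Z}^m\to\langle t_1-1\rangle\times\cdots\times\langle t_m-1\rangle$ maps $\mathbf{x}$ to $\mathbf{z}$ with $z_i\in\langle t_i-1\rangle$, $x_i+z_i\equiv0\pmod{t_i}$ (a bijection). For $\mathbf{r}\in\mathbb{N}^m$, $\operatorname{asc}_{\mathbf{t}}(\mathbf{r})=\#\{i\le m-1:r_i/t_i<r_{i+1}/t_{i+1}\}$. $\mathcal{L}^i(S)$ is the set of lattice points of $S$ with last coordinate $i$, $\ell^i(S)=\#\mathcal{L}^i(S)$. -}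

module Defs where

open import Data.Nat as ℕ using (ℕ; zero; suc; _∸_)
open import Data.Integer as ℤ using (ℤ; +_)
open import Data.Rational as ℚ using (ℚ; 0ℚ; 1ℚ)
open import Data.Fin as Fin using (Fin; toℕ)
open import Data.Fin.Properties using (_≤?_)
open import Data.Vec as Vec using (Vec; []; _∷_; lookup; tabulate; foldr′)
open import Data.List using (List; length)
open import Data.List.Membership.Propositional using (_∈_)
open import Data.List.Relation.Unary.Unique.Propositional using (Unique)
open import Data.Product using (_×_; ∃-syntax)
open import Relation.Binary.PropositionalEquality using (_≡_)
open import Relation.Nullary using (does)
open import Data.Bool using (if_then_else_)
open import Function.Bundles using (_⇔_)

-- ⟨N⟩ membership for a coordinate: 0 ≤ r ≤ N
-- Ψ_n = ⟨s_1-1⟩ × ⋯ × ⟨s_n-1⟩ as a predicate on Vec ℕ n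
InΨ : ∀ {n} → Vec ℕ n → Vec ℕ n → Set
InΨ {n} s r = (k : Fin n) → lookup r k ℕ.≤ lookup s k ∸ 1

-- j-th generator w_j evaluated at coordinate i: 0 if i < j, t_i if i ≥ j
wcoord : ∀ {m} → Vec ℕ m → Fin m → Fin m → ℕ
wcoord t j i = if does (j ≤? i) then lookup t i else 0

ℕtoℚ : ℕ → ℚ
ℕtoℚ a = (+ a) ℚ./ 1

Σℚ : ∀ {m} → Vec ℚ m → ℚ
Σℚ = foldr′ ℚ._+_ 0ℚ

-- x ∈ Par_t ∩ ℤ^m : x = Σ_j c_j w_j with 0 ≤ c_j < 1
-- (the c_j are uniquely determined by x and rational)
InPar : ∀ {m} → Vec ℕ m → Vec ℤ m → Set
InPar {m} t x =
  ∃[ c ] (((j : Fin m) → (0ℚ ℚ.≤ lookup c j) × (lookup c j ℚ.< 1ℚ))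
         × ((i : Fin m) → (lookup x i ℚ./ 1) ≡ Σℚ (tabulate (λ j → lookup c j ℚ.* ℕtoℚ (wcoord t j i)))))

-- the unique z ∈ ⟨t-1⟩ with x + z ≡ 0 (mod t)  (t assumed positive)
negRem : ℤ → ℕ → ℕ
negRem x zero = 0
negRem x (suc k) = (ℤ.- x) ℤ.%ℕ suc k

REM : ∀ {m} → Vec ℕ m → Vec ℤ m → Vec ℕ m
REM t x = Vec.zipWith negRem x t

-- ascent indicator: r_i/t_i < r_{i+1}/t_{i+1}, i.e. r_i t_{i+1} < r_{i+1} t_i (t positive)
ascStep : ℕ → ℕ → ℕ → ℕ → ℕ
ascStep t0 t1 r0 r1 = if does ((r0 ℕ.* t1) ℕ.<? (r1 ℕ.* t0)) then 1 else 0

asc : ∀ {m} → Vec ℕ m → Vec ℕ m → ℕ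
asc (t0 ∷ t1 ∷ ts) (r0 ∷ r1 ∷ rs) = ascStep t0 t1 r0 r1 ℕ.+ asc (t1 ∷ ts) (r1 ∷ rs)
asc _ _ = 0

_HasSize_ : {A : Set} → (A → Set) → ℕ → Set
_HasSize_ {A} P k = ∃[ xs ] (Unique xs × (length xs ≡ k) × ((a : A) → (a ∈ xs) ⇔ P a))

{-# OPTIONS --safe #-}
-- A lattice point x = Σ c_j w_j of Par_t has x_i = A_i t_i with A_i = c_1 + ⋯ + c_i. Writing
-- x_i = q_i t_i - z_i with z = REM_t(x), the increment c_i = (q_i - q_{i-1}) - z_i/t_i + z_{i-1}/t_{i-1}
-- lies in [0,1), and this forces q_i - q_{i-1} to be the indicator of z_{i-1}/t_{i-1} < z_i/t_i.
-- So x is determined by z, every z in the box occurs, and q_i counts the ascents of (0, z_1, …, z_i)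
-- with respect to (1, t_1, …, t_i). For s* the last coordinate has modulus 1 and remainder 0, so it
-- equals that count; s_1 = 1 forces z_1 = 0, so the step from the initial 0 is not an ascent.
module Submission where

open import Defs
open import Data.Nat as ℕ using (ℕ; zero; suc; z≤n; s≤s; _≤_; NonZero)
import Data.Nat.Properties as ℕP
open import Data.Integer as ℤ using (ℤ; +_; -[1+_])
import Data.Integer.Properties as ℤP
import Data.Integer.DivMod as ℤD
open import Data.Rational as ℚ using (ℚ; mkℚ; 0ℚ; 1ℚ)
import Data.Rational.Properties as ℚP
import Data.Nat.Coprimality as Coprime
open import Data.Fin as Fin using (Fin; toℕ)
open import Data.Vec as Vec using (Vec; []; _∷_; _∷ʳ_; lookup; tabulate; head; last; init; initLast)
import Data.Vec.Properties as VecP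
open import Data.Vec.Relation.Unary.All using (All; []; _∷_)
import Data.Vec.Relation.Unary.All.Properties as AllP
open import Data.Vec.Relation.Binary.Pointwise.Inductive using (Pointwise; []; _∷_)
open import Data.List as List using (List; length; filter)
open import Data.List.Membership.Propositional using (_∈_)
open import Data.List.Membership.Propositional.Properties
  using (∈-map⁺; ∈-map⁻; ∈-filter⁺; ∈-filter⁻; ∈-upTo⁺; ∈-upTo⁻; ∈-cartesianProductWith⁺; ∈-cartesianProductWith⁻)
import Data.List.Properties as ListP
open import Data.List.Relation.Unary.Any using (here)
import Data.List.Relation.Unary.All as ListAll
import Data.List.Relation.Unary.AllPairs as AllPairs
open import Data.List.Relation.Unary.Unique.Propositional using (Unique)
import Data.List.Relation.Unary.Unique.Propositional.Properties as UniqueP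
open import Data.Product using (_×_; _,_; proj₁; proj₂; ∃-syntax)
open import Data.Sum using (_⊎_; inj₁; inj₂)
open import Data.Unit using (⊤; tt)
open import Data.Bool using (if_then_else_)
open import Data.Empty using (⊥-elim)
open import Function using (_∘_)
open import Function.Bundles using (_⇔_; mk⇔; Equivalence)
import Function.Properties.Equivalence as ⇔
open import Relation.Binary.PropositionalEquality
open import Relation.Nullary using (yes; no)
open import Relation.Nullary.Decidable using (dec-true; dec-false)
open import Relation.Unary using (Decidable)
import Data.Rational.Solver as ℚSolver
import Data.Integer.Solver as ℤSolver

fromℤ : ℤ → ℚ
fromℤ k = mkℚ k 0 (Coprime.sym (Coprime.1-coprimeTo ℤ.∣ k ∣))

/1≡fromℤ : ∀ k → k ℚ./ 1 ≡ fromℤ k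
/1≡fromℤ k = ℚP.↥p/↧p≡p (fromℤ k)

fromℤ-+ : ∀ a b → fromℤ (a ℤ.+ b) ≡ fromℤ a ℚ.+ fromℤ b
fromℤ-+ a b =
  sym (trans (cong (ℚ._/ 1) (cong₂ ℤ._+_ (ℤP.*-identityʳ a) (ℤP.*-identityʳ b))) (/1≡fromℤ (a ℤ.+ b)))

fromℤ-* : ∀ a b → fromℤ (a ℤ.* b) ≡ fromℤ a ℚ.* fromℤ b
fromℤ-* a b = sym (/1≡fromℤ (a ℤ.* b))

fromℤ-neg : ∀ a → fromℤ (ℤ.- a) ≡ ℚ.- fromℤ a
fromℤ-neg (+ zero) = refl
fromℤ-neg (+ suc n) = refl
fromℤ-neg -[1+ n ] = refl

fromℤ-*-minus : ∀ q t z → fromℤ (q ℤ.* t ℤ.- z) ≡ fromℤ q ℚ.* fromℤ t ℚ.- fromℤ z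
fromℤ-*-minus q t z = trans (fromℤ-+ (q ℤ.* t) (ℤ.- z)) (cong₂ ℚ._+_ (fromℤ-* q t) (fromℤ-neg z))

fromℤ-mono-≤ : ∀ {a b} → a ℤ.≤ b → fromℤ a ℚ.≤ fromℤ b
fromℤ-mono-≤ {a} {b} p = ℚ.*≤* (subst₂ ℤ._≤_ (sym (ℤP.*-identityʳ a)) (sym (ℤP.*-identityʳ b)) p)

fromℤ-mono-< : ∀ {a b} → a ℤ.< b → fromℤ a ℚ.< fromℤ b
fromℤ-mono-< {a} {b} p = ℚ.*<* (subst₂ ℤ._<_ (sym (ℤP.*-identityʳ a)) (sym (ℤP.*-identityʳ b)) p)

fromℤ-cancel-< : ∀ {a b} → fromℤ a ℚ.< fromℤ b → a ℤ.< b
fromℤ-cancel-< {a} {b} (ℚ.*<* p) = subst₂ ℤ._<_ (ℤP.*-identityʳ a) (ℤP.*-identityʳ b) p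

-- The unit interval and the carry of one step

InUnit : ℚ → Set
InUnit c = (0ℚ ℚ.≤ c) × (c ℚ.< 1ℚ)

module _ where
  open ℚSolver.+-*-Solver

  p≤q⇒0≤q-p : ∀ {p q} → p ℚ.≤ q → 0ℚ ℚ.≤ q ℚ.- p
  p≤q⇒0≤q-p {p} {q} p≤q = subst (ℚ._≤ q ℚ.- p) (ℚP.+-inverseʳ p) (ℚP.+-monoˡ-≤ (ℚ.- p) p≤q)

  p<q⇒0<q-p : ∀ {p q} → p ℚ.< q → 0ℚ ℚ.< q ℚ.- p
  p<q⇒0<q-p {p} {q} p<q = subst (ℚ._< q ℚ.- p) (ℚP.+-inverseʳ p) (ℚP.+-monoˡ-< (ℚ.- p) p<q)

  0<q-p⇒p<q : ∀ {p q} → 0ℚ ℚ.< q ℚ.- p → p ℚ.< q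
  0<q-p⇒p<q {p} {q} 0<q-p =
    subst₂ ℚ._<_ (ℚP.+-identityˡ p) (solve 2 (λ p q → (q :- p) :+ p := q) refl p q) (ℚP.+-monoˡ-< p 0<q-p)

  0<k<2⇒k≡1 : ∀ k → fromℤ (+ 0) ℚ.< fromℤ k → fromℤ k ℚ.< fromℤ (+ 2) → k ≡ + 1
  0<k<2⇒k≡1 k 0<k k<2 = pin k (fromℤ-cancel-< 0<k) (fromℤ-cancel-< k<2)
    where
    pin : ∀ k → + 0 ℤ.< k → k ℤ.< + 2 → k ≡ + 1
    pin (+ 1) _ _ = refl
    pin (+ 0) (ℤ.+<+ ()) _
    pin (+ suc (suc n)) _ (ℤ.+<+ (s≤s (s≤s ())))

  -1<k<1⇒k≡0 : ∀ k → fromℤ -[1+ 0 ] ℚ.< fromℤ k → fromℤ k ℚ.< fromℤ (+ 1) → k ≡ + 0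
  -1<k<1⇒k≡0 k -1<k k<1 = pin k (fromℤ-cancel-< -1<k) (fromℤ-cancel-< k<1)
    where
    pin : ∀ k → -[1+ 0 ] ℤ.< k → k ℤ.< + 1 → k ≡ + 0
    pin (+ 0) _ _ = refl
    pin (+ suc n) _ (ℤ.+<+ (s≤s ()))
    pin -[1+ n ] (ℤ.-<- ()) _

  module _ {a b : ℚ} (a∈ : InUnit a) (b∈ : InUnit b) where

    carry≡1 : ∀ k → a ℚ.< b → InUnit (fromℤ k ℚ.- b ℚ.+ a) → k ≡ + 1
    carry≡1 k a<b (0≤e , e<1) = 0<k<2⇒k≡1 k
      (0<q-p⇒p<q (subst (0ℚ ℚ.<_) (solve 3 (λ K a b → (b :- a) :+ (K :- b :+ a) := K :- con (fromℤ (+ 0))) refl (fromℤ k) a b)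
        (ℚP.+-mono-<-≤ (p<q⇒0<q-p a<b) 0≤e)))
      (0<q-p⇒p<q (subst (0ℚ ℚ.<_)
        (solve 3 (λ K a b → ((con 1ℚ :- (K :- b :+ a)) :+ (con 1ℚ :- b)) :+ a := con (fromℤ (+ 2)) :- K) refl (fromℤ k) a b)
        (ℚP.+-mono-<-≤ (ℚP.+-mono-<-≤ (p<q⇒0<q-p e<1) (ℚP.<⇒≤ (p<q⇒0<q-p (proj₂ b∈)))) (proj₁ a∈))))

    carry≡0 : ∀ k → b ℚ.≤ a → InUnit (fromℤ k ℚ.- b ℚ.+ a) → k ≡ + 0
    carry≡0 k b≤a (0≤e , e<1) = -1<k<1⇒k≡0 k
      (0<q-p⇒p<q (subst (0ℚ ℚ.<_)
        (solve 3 (λ K a b → (con 1ℚ :- a) :+ ((K :- b :+ a) :+ b) := K :- con (fromℤ -[1+ 0 ])) refl (fromℤ k) a b)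
        (ℚP.+-mono-<-≤ (p<q⇒0<q-p (proj₂ a∈)) (ℚP.+-mono-≤ 0≤e (proj₁ b∈)))))
      (0<q-p⇒p<q (subst (0ℚ ℚ.<_)
        (solve 3 (λ K a b → (con 1ℚ :- (K :- b :+ a)) :+ (a :- b) := con (fromℤ (+ 1)) :- K) refl (fromℤ k) a b)
        (ℚP.+-mono-<-≤ (p<q⇒0<q-p e<1) (p≤q⇒0≤q-p b≤a))))

    carry1-inUnit : a ℚ.< b → InUnit (fromℤ (+ 1) ℚ.- b ℚ.+ a)
    carry1-inUnit a<b =
      subst (0ℚ ℚ.≤_) (solve 2 (λ a b → (con 1ℚ :- b) :+ a := con (fromℤ (+ 1)) :- b :+ a) refl a b)
        (ℚP.+-mono-≤ (ℚP.<⇒≤ (p<q⇒0<q-p (proj₂ b∈))) (proj₁ a∈)) ,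
      0<q-p⇒p<q (subst (0ℚ ℚ.<_) (solve 2 (λ a b → b :- a := con 1ℚ :- (con (fromℤ (+ 1)) :- b :+ a)) refl a b)
        (p<q⇒0<q-p a<b))

    carry0-inUnit : b ℚ.≤ a → InUnit (fromℤ (+ 0) ℚ.- b ℚ.+ a)
    carry0-inUnit b≤a =
      subst (0ℚ ℚ.≤_) (solve 2 (λ a b → a :- b := con (fromℤ (+ 0)) :- b :+ a) refl a b) (p≤q⇒0≤q-p b≤a) ,
      0<q-p⇒p<q (subst (0ℚ ℚ.<_) (solve 2 (λ a b → (con 1ℚ :- a) :+ b := con 1ℚ :- (con (fromℤ (+ 0)) :- b :+ a)) refl a b)
        (ℚP.+-mono-<-≤ (p<q⇒0<q-p (proj₂ a∈)) (proj₁ b∈)))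

fraction : ℕ → (t : ℕ) → .{{NonZero t}} → ℚ
fraction z (suc t) = fromℤ (+ z) ℚ.* ℚ.1/ fromℤ (+ suc t)

module _ where
  open ≡-Reasoning
  open ℚSolver.+-*-Solver

  fraction-*-denominator : ∀ z t → fraction z (suc t) ℚ.* fromℤ (+ suc t) ≡ fromℤ (+ z)
  fraction-*-denominator z t = begin
    fromℤ (+ z) ℚ.* ℚ.1/ T ℚ.* T      ≡⟨ ℚP.*-assoc (fromℤ (+ z)) (ℚ.1/ T) T ⟩
    fromℤ (+ z) ℚ.* (ℚ.1/ T ℚ.* T)    ≡⟨ cong (fromℤ (+ z) ℚ.*_) (ℚP.*-inverseˡ T) ⟩
    fromℤ (+ z) ℚ.* 1ℚ                ≡⟨ ℚP.*-identityʳ (fromℤ (+ z)) ⟩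
    fromℤ (+ z)                       ∎
    where T = fromℤ (+ suc t)

  fraction-*-multiple : ∀ z t u → fraction z (suc t) ℚ.* fromℤ (+ (suc t ℕ.* suc u)) ≡ fromℤ (+ (z ℕ.* suc u))
  fraction-*-multiple z t u = begin
    fraction z (suc t) ℚ.* fromℤ (+ (suc t ℕ.* suc u))
      ≡⟨ cong (fraction z (suc t) ℚ.*_) (trans (cong fromℤ (ℤP.pos-* (suc t) (suc u))) (fromℤ-* (+ suc t) (+ suc u))) ⟩
    fraction z (suc t) ℚ.* (fromℤ (+ suc t) ℚ.* fromℤ (+ suc u))
      ≡⟨ sym (ℚP.*-assoc (fraction z (suc t)) (fromℤ (+ suc t)) (fromℤ (+ suc u))) ⟩
    fraction z (suc t) ℚ.* fromℤ (+ suc t) ℚ.* fromℤ (+ suc u)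
      ≡⟨ cong (ℚ._* fromℤ (+ suc u)) (fraction-*-denominator z t) ⟩
    fromℤ (+ z) ℚ.* fromℤ (+ suc u)
      ≡⟨ sym (trans (cong fromℤ (ℤP.pos-* z (suc u))) (fromℤ-* (+ z) (+ suc u))) ⟩
    fromℤ (+ (z ℕ.* suc u)) ∎

  fraction-mono-< : ∀ zp tp z t → zp ℕ.* suc t ℕ.< z ℕ.* suc tp → fraction zp (suc tp) ℚ.< fraction z (suc t)
  fraction-mono-< zp tp z t lt = ℚP.*-cancelʳ-<-nonNeg (fromℤ (+ (suc tp ℕ.* suc t)))
    (subst₂ ℚ._<_ (sym (fraction-*-multiple zp tp t))
       (sym (trans (cong (λ w → fraction z (suc t) ℚ.* fromℤ (+ w)) (ℕP.*-comm (suc tp) (suc t))) (fraction-*-multiple z t tp)))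
       (fromℤ-mono-< (ℤ.+<+ lt)))

  fraction-mono-≤ : ∀ zp tp z t → z ℕ.* suc tp ℕ.≤ zp ℕ.* suc t → fraction z (suc t) ℚ.≤ fraction zp (suc tp)
  fraction-mono-≤ zp tp z t le = ℚP.*-cancelʳ-≤-pos (fromℤ (+ (suc tp ℕ.* suc t)))
    (subst₂ ℚ._≤_
       (sym (trans (cong (λ w → fraction z (suc t) ℚ.* fromℤ (+ w)) (ℕP.*-comm (suc tp) (suc t))) (fraction-*-multiple z t tp)))
       (sym (fraction-*-multiple zp tp t))
       (fromℤ-mono-≤ (ℤ.+≤+ le)))

  fraction-inUnit : ∀ z t → z ℕ.< suc t → InUnit (fraction z (suc t))
  fraction-inUnit z t z<t =
    fraction-mono-≤ z t 0 0 z≤n ,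
    fraction-mono-< z t 1 0 (subst₂ ℕ._<_ (sym (ℕP.*-identityʳ z)) (sym (ℕP.*-identityˡ (suc t))) z<t)

  *-denominator⇒-fraction : ∀ u v w t → u ℚ.* fromℤ (+ suc t) ≡ v ℚ.* fromℤ (+ suc t) ℚ.- fromℤ (+ w) →
                            u ≡ v ℚ.- fraction w (suc t)
  *-denominator⇒-fraction u v w t eq = begin
    u                                    ≡⟨ sym (ℚP.*-identityʳ u) ⟩
    u ℚ.* 1ℚ                             ≡⟨ cong (u ℚ.*_) (sym (ℚP.*-inverseʳ T)) ⟩
    u ℚ.* (T ℚ.* I)                      ≡⟨ sym (ℚP.*-assoc u T I) ⟩
    u ℚ.* T ℚ.* I                        ≡⟨ cong (ℚ._* I) eq ⟩
    (v ℚ.* T ℚ.- W) ℚ.* I                ≡⟨ solve 4 (λ v T W I → (v :* T :- W) :* I := v :* (T :* I) :- W :* I) refl v T W I ⟩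
    v ℚ.* (T ℚ.* I) ℚ.- W ℚ.* I          ≡⟨ cong (λ k → v ℚ.* k ℚ.- W ℚ.* I) (ℚP.*-inverseʳ T) ⟩
    v ℚ.* 1ℚ ℚ.- W ℚ.* I                 ≡⟨ cong (ℚ._- W ℚ.* I) (ℚP.*-identityʳ v) ⟩
    v ℚ.- fraction w (suc t)             ∎
    where T = fromℤ (+ suc t)
          I = ℚ.1/ fromℤ (+ suc t)
          W = fromℤ (+ w)

ascStep-cases : ∀ tp t zp z →
  (zp ℕ.* t ℕ.< z ℕ.* tp × ascStep tp t zp z ≡ 1) ⊎ (z ℕ.* tp ℕ.≤ zp ℕ.* t × ascStep tp t zp z ≡ 0)
ascStep-cases tp t zp z with (zp ℕ.* t) ℕ.<? (z ℕ.* tp)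
... | yes lt = inj₁ (lt , cong (λ b → if b then 1 else 0) (dec-true ((zp ℕ.* t) ℕ.<? (z ℕ.* tp)) lt))
... | no ¬lt = inj₂ (ℕP.≮⇒≥ ¬lt , cong (λ b → if b then 1 else 0) (dec-false ((zp ℕ.* t) ℕ.<? (z ℕ.* tp)) ¬lt))

module _ {zp tp z t : ℕ} (zp<tp : zp ℕ.< suc tp) (z<t : z ℕ.< suc t) where
  private
    a∈ = fraction-inUnit zp tp zp<tp
    b∈ = fraction-inUnit z t z<t

  carry≡ascStep : ∀ k → InUnit (fromℤ k ℚ.- fraction z (suc t) ℚ.+ fraction zp (suc tp)) →
                  k ≡ + ascStep (suc tp) (suc t) zp z
  carry≡ascStep k k∈ with ascStep-cases (suc tp) (suc t) zp z
  ... | inj₁ (lt , eq) = trans (carry≡1 a∈ b∈ k (fraction-mono-< zp tp z t lt) k∈) (cong +_ (sym eq))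
  ... | inj₂ (ge , eq) = trans (carry≡0 a∈ b∈ k (fraction-mono-≤ zp tp z t ge) k∈) (cong +_ (sym eq))

  ascStep-inUnit : InUnit (fromℤ (+ ascStep (suc tp) (suc t) zp z) ℚ.- fraction z (suc t) ℚ.+ fraction zp (suc tp))
  ascStep-inUnit with ascStep-cases (suc tp) (suc t) zp z
  ... | inj₁ (lt , eq) rewrite eq = carry1-inUnit a∈ b∈ (fraction-mono-< zp tp z t lt)
  ... | inj₂ (ge , eq) rewrite eq = carry0-inUnit a∈ b∈ (fraction-mono-≤ zp tp z t ge)

-- Lattice points of Par_t, described one coordinate at a time

-- With A_i = acc + c_1 + ⋯ + c_i, coordinate i of acc·(t_i)_i + Σ_j c_j w_j is A_i t_i.
partialSums : ∀ {m} → ℚ → Vec ℕ m → Vec ℚ m → Vec ℚ m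
partialSums acc [] [] = []
partialSums acc (t ∷ ts) (c ∷ cs) = (acc ℚ.+ c) ℚ.* fromℤ (+ t) ∷ partialSums (acc ℚ.+ c) ts cs

module _ where
  open ≡-Reasoning
  open ℚSolver.+-*-Solver

  wcoord-suc : ∀ {m} t (ts : Vec ℕ m) j i → wcoord (t ∷ ts) (Fin.suc j) (Fin.suc i) ≡ wcoord ts j i
  wcoord-suc t ts j i = cong (λ b → if b then lookup ts i else 0) (<ᵇ-suc (toℕ j) (toℕ i))
    where
    <ᵇ-suc : ∀ a b → (a ℕ.<ᵇ suc b) ≡ (a ℕ.≤ᵇ b)
    <ᵇ-suc zero b = refl
    <ᵇ-suc (suc a) b = refl

  Σℚ-*0 : ∀ {m} (cs : Vec ℚ m) → Σℚ (tabulate (λ j → lookup cs j ℚ.* ℕtoℚ 0)) ≡ 0ℚ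
  Σℚ-*0 [] = refl
  Σℚ-*0 (c ∷ cs) = cong₂ ℚ._+_ (ℚP.*-zeroʳ c) (Σℚ-*0 cs)

  Σℚ-wcoord≡partialSums : ∀ {m} acc (t : Vec ℕ m) (c : Vec ℚ m) i →
    acc ℚ.* fromℤ (+ lookup t i) ℚ.+ Σℚ (tabulate (λ j → lookup c j ℚ.* ℕtoℚ (wcoord t j i)))
      ≡ lookup (partialSums acc t c) i
  Σℚ-wcoord≡partialSums acc (t ∷ ts) (c ∷ cs) Fin.zero = begin
    acc ℚ.* T ℚ.+ (c ℚ.* ℕtoℚ t ℚ.+ Σℚ (tabulate (λ j → lookup cs j ℚ.* ℕtoℚ 0)))
      ≡⟨ cong₂ (λ u v → acc ℚ.* T ℚ.+ (c ℚ.* u ℚ.+ v)) (/1≡fromℤ (+ t)) (Σℚ-*0 cs) ⟩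
    acc ℚ.* T ℚ.+ (c ℚ.* T ℚ.+ 0ℚ)
      ≡⟨ solve 3 (λ a c T → a :* T :+ (c :* T :+ con 0ℚ) := (a :+ c) :* T) refl acc c T ⟩
    (acc ℚ.+ c) ℚ.* T ∎
    where T = fromℤ (+ t)
  Σℚ-wcoord≡partialSums acc (t ∷ ts) (c ∷ cs) (Fin.suc i) = begin
    acc ℚ.* T ℚ.+ (c ℚ.* ℕtoℚ (lookup ts i) ℚ.+ Σℚ (tabulate (λ j → lookup cs j ℚ.* ℕtoℚ (wcoord (t ∷ ts) (Fin.suc j) (Fin.suc i)))))
      ≡⟨ cong₂ (λ u v → acc ℚ.* T ℚ.+ (c ℚ.* u ℚ.+ v)) (/1≡fromℤ (+ lookup ts i))
           (cong Σℚ (VecP.tabulate-cong (λ j → cong (λ w → lookup cs j ℚ.* ℕtoℚ w) (wcoord-suc t ts j i)))) ⟩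
    acc ℚ.* T ℚ.+ (c ℚ.* T ℚ.+ S)
      ≡⟨ solve 4 (λ a c T S → a :* T :+ (c :* T :+ S) := (a :+ c) :* T :+ S) refl acc c T S ⟩
    (acc ℚ.+ c) ℚ.* T ℚ.+ S
      ≡⟨ Σℚ-wcoord≡partialSums (acc ℚ.+ c) ts cs i ⟩
    lookup (partialSums (acc ℚ.+ c) ts cs) i ∎
    where T = fromℤ (+ lookup ts i)
          S = Σℚ (tabulate (λ j → lookup cs j ℚ.* ℕtoℚ (wcoord ts j i)))

-- x ∈ acc·(t_i)_i + Par_t, unfolded coordinatewise: x_i = A_i t_i with increments c_i ∈ [0,1).
InParFrom : ∀ {m} → ℚ → Vec ℕ m → Vec ℤ m → Set
InParFrom acc [] [] = ⊤
InParFrom acc (t ∷ ts) (x ∷ xs) =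
  ∃[ c ] (InUnit c × fromℤ x ≡ (acc ℚ.+ c) ℚ.* fromℤ (+ t) × InParFrom (acc ℚ.+ c) ts xs)

InParFrom⇔partialSums : ∀ {m} acc (t : Vec ℕ m) (x : Vec ℤ m) →
  InParFrom acc t x ⇔
  (∃[ c ] (((j : Fin m) → InUnit (lookup c j)) × ((i : Fin m) → fromℤ (lookup x i) ≡ lookup (partialSums acc t c) i)))
InParFrom⇔partialSums acc t x = mk⇔ (elim acc t x) (λ (c , c∈ , x≡) → intro acc t x c c∈ x≡)
  where
  elim : ∀ {m} acc (t : Vec ℕ m) (x : Vec ℤ m) → InParFrom acc t x →
    ∃[ c ] (((j : Fin m) → InUnit (lookup c j)) × ((i : Fin m) → fromℤ (lookup x i) ≡ lookup (partialSums acc t c) i))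
  elim acc [] [] tt = [] , (λ ()) , (λ ())
  elim acc (t ∷ ts) (x ∷ xs) (c , c∈ , x≡ , rest) with elim (acc ℚ.+ c) ts xs rest
  ... | cs , cs∈ , xs≡ = c ∷ cs , (λ { Fin.zero → c∈ ; (Fin.suc j) → cs∈ j }) , (λ { Fin.zero → x≡ ; (Fin.suc i) → xs≡ i })
  intro : ∀ {m} acc (t : Vec ℕ m) (x : Vec ℤ m) (c : Vec ℚ m) → (∀ j → InUnit (lookup c j)) →
    (∀ i → fromℤ (lookup x i) ≡ lookup (partialSums acc t c) i) → InParFrom acc t x
  intro acc [] [] [] _ _ = tt
  intro acc (t ∷ ts) (x ∷ xs) (c ∷ cs) c∈ x≡ =
    c , c∈ Fin.zero , x≡ Fin.zero , intro (acc ℚ.+ c) ts xs cs (c∈ ∘ Fin.suc) (x≡ ∘ Fin.suc)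

InPar⇔InParFrom0 : ∀ {m} (t : Vec ℕ m) (x : Vec ℤ m) → InPar t x ⇔ InParFrom 0ℚ t x
InPar⇔InParFrom0 t x = ⇔.trans (mk⇔ to from) (⇔.sym (InParFrom⇔partialSums 0ℚ t x))
  where
  0*+ : ∀ i S → 0ℚ ℚ.* fromℤ (+ lookup t i) ℚ.+ S ≡ S
  0*+ i S = trans (cong (ℚ._+ S) (ℚP.*-zeroˡ (fromℤ (+ lookup t i)))) (ℚP.+-identityˡ S)
  to : InPar t x → _
  to (c , c∈ , x≡) = c , c∈ , λ i →
    trans (sym (/1≡fromℤ (lookup x i))) (trans (x≡ i) (trans (sym (0*+ i _)) (Σℚ-wcoord≡partialSums 0ℚ t c i)))
  from : _ → InPar t x
  from (c , c∈ , x≡) = c , c∈ , λ i →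
    trans (/1≡fromℤ (lookup x i)) (trans (x≡ i) (trans (sym (Σℚ-wcoord≡partialSums 0ℚ t c i)) (0*+ i _)))

quot : ℤ → ℕ → ℤ
quot x zero = + 0
quot x (suc t) = ℤ.- ((ℤ.- x) ℤ./ℕ suc t)

r≢r'+multiple : ∀ r r' k t → r ℕ.< suc t → + r ≢ + r' ℤ.+ + suc k ℤ.* + suc t
r≢r'+multiple r r' k t r<t eq = ℕP.<⇒≱ r<t (begin
  suc t                        ≤⟨ ℕP.m≤n*m (suc t) (suc k) ⟩
  suc k ℕ.* suc t              ≤⟨ ℕP.m≤n+m _ r' ⟩
  r' ℕ.+ suc k ℕ.* suc t       ≡⟨ ℤP.+-injective (trans (cong (λ w → + r' ℤ.+ w) (sym (ℤP.pos-* (suc k) (suc t)))) (sym eq)) ⟩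
  r                            ∎)
  where open ℕP.≤-Reasoning

module _ where
  open ≡-Reasoning
  open ℤSolver.+-*-Solver

  x≡quot*t-negRem : ∀ x t → x ≡ quot x (suc t) ℤ.* + suc t ℤ.- + negRem x (suc t)
  x≡quot*t-negRem x t = begin
    x                                ≡⟨ sym (ℤP.neg-involutive x) ⟩
    ℤ.- (ℤ.- x)                      ≡⟨ cong ℤ.-_ (ℤD.a≡a%ℕn+[a/ℕn]*n (ℤ.- x) (suc t)) ⟩
    ℤ.- (+ r ℤ.+ d ℤ.* + suc t)      ≡⟨ solve 3 (λ R D T → :- (R :+ D :* T) := (:- D) :* T :- R) refl (+ r) d (+ suc t) ⟩
    ℤ.- d ℤ.* + suc t ℤ.- + r        ∎
    where r = (ℤ.- x) ℤ.%ℕ suc t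
          d = (ℤ.- x) ℤ./ℕ suc t

  negRem< : ∀ x t → negRem x (suc t) ℕ.< suc t
  negRem< x t = ℤD.n%ℕd<d (ℤ.- x) (suc t)

  remainder-unique : ∀ r r' j t → r ℕ.< suc t → r' ℕ.< suc t → + r ≡ + r' ℤ.+ j ℤ.* + suc t → r ≡ r'
  remainder-unique r r' (+ zero) t _ _ eq = trans (ℤP.+-injective eq) (ℕP.+-identityʳ r')
  remainder-unique r r' (+ suc k) t r<t _ eq = ⊥-elim (r≢r'+multiple r r' k t r<t eq)
  remainder-unique r r' -[1+ k ] t _ r'<t eq = ⊥-elim (r≢r'+multiple r' r k t r'<t (begin
    + r'                                          ≡⟨ solve 3 (λ R' K T → R' := (R' :+ (:- K) :* T) :+ K :* T) refl (+ r') (+ suc k) (+ suc t) ⟩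
    (+ r' ℤ.+ -[1+ k ] ℤ.* + suc t) ℤ.+ + suc k ℤ.* + suc t ≡⟨ cong (ℤ._+ + suc k ℤ.* + suc t) (sym eq) ⟩
    + r ℤ.+ + suc k ℤ.* + suc t                   ∎))

  negRem-*-minus : ∀ q z t → z ℕ.< suc t → negRem (q ℤ.* + suc t ℤ.- + z) (suc t) ≡ z
  negRem-*-minus q z t z<t = sym (remainder-unique z r (d ℤ.- ℤ.- q) t z<t (negRem< x t) (begin
    + z                                        ≡⟨ solve 3 (λ Z Q T → Z := :- (Q :* T :- Z) :+ Q :* T) refl (+ z) q (+ suc t) ⟩
    ℤ.- x ℤ.+ q ℤ.* + suc t                    ≡⟨ cong (ℤ._+ q ℤ.* + suc t) (ℤD.a≡a%ℕn+[a/ℕn]*n (ℤ.- x) (suc t)) ⟩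
    + r ℤ.+ d ℤ.* + suc t ℤ.+ q ℤ.* + suc t    ≡⟨ solve 4 (λ R D Q T → R :+ D :* T :+ Q :* T := R :+ (D :- (:- Q)) :* T) refl (+ r) d q (+ suc t) ⟩
    + r ℤ.+ (d ℤ.- ℤ.- q) ℤ.* + suc t          ∎))
    where x = q ℤ.* + suc t ℤ.- + z
          r = negRem x (suc t)
          d = (ℤ.- x) ℤ./ℕ suc t

-- The inverse of REM

-- The state (q, zp, tp) encodes the partial sum A = q - zp/tp reached so far; each step adds
-- the carry [zp/tp < z/t] to q, as forced by the carry lemmas.
REM⁻¹-from : ∀ {m} → ℤ → ℕ → ℕ → Vec ℕ m → Vec ℕ m → Vec ℤ m
REM⁻¹-from q zp tp [] [] = []
REM⁻¹-from q zp tp (t ∷ ts) (z ∷ zs) =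
  (q ℤ.+ + ascStep tp t zp z) ℤ.* + t ℤ.- + z ∷ REM⁻¹-from (q ℤ.+ + ascStep tp t zp z) z t ts zs

REM⁻¹ : ∀ {m} → Vec ℕ m → Vec ℕ m → Vec ℤ m
REM⁻¹ = REM⁻¹-from (+ 0) 0 1

REM-REM⁻¹-from : ∀ {m} q zp tp (t z : Vec ℕ m) → Pointwise ℕ._<_ z t → REM t (REM⁻¹-from q zp tp t z) ≡ z
REM-REM⁻¹-from q zp tp [] [] [] = refl
REM-REM⁻¹-from q zp tp (zero ∷ ts) (z ∷ zs) (() ∷ _)
REM-REM⁻¹-from q zp tp (suc t ∷ ts) (z ∷ zs) (z<t ∷ zs<ts) =
  cong₂ _∷_ (negRem-*-minus (q ℤ.+ + ascStep tp (suc t) zp z) z t z<t) (REM-REM⁻¹-from _ z (suc t) ts zs zs<ts)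

last-REM⁻¹-from : ∀ {m} q zp tp (t z : Vec ℕ (suc m)) →
  last (REM⁻¹-from q zp tp t z) ≡ (q ℤ.+ + asc (tp ∷ t) (zp ∷ z)) ℤ.* + last t ℤ.- + last z
last-REM⁻¹-from q zp tp (t ∷ []) (z ∷ []) =
  cong (λ k → (q ℤ.+ + k) ℤ.* + t ℤ.- + z) (sym (ℕP.+-identityʳ (ascStep tp t zp z)))
last-REM⁻¹-from q zp tp (t ∷ t′ ∷ ts) (z ∷ z′ ∷ zs) =
  trans (last-REM⁻¹-from (q ℤ.+ + ascStep tp t zp z) z t (t′ ∷ ts) (z′ ∷ zs))
        (cong (λ k → k ℤ.* + last (t′ ∷ ts) ℤ.- + last (z′ ∷ zs))
              (trans (ℤP.+-assoc q _ _) (cong (ℤ._+_ q) (sym (ℤP.pos-+ (ascStep tp t zp z) _)))))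

module _ where
  open ≡-Reasoning
  open ℚSolver.+-*-Solver

  increment≡carry : ∀ {acc c} q k a b → acc ≡ fromℤ q ℚ.- a → acc ℚ.+ c ≡ fromℤ (q ℤ.+ k) ℚ.- b →
                    c ≡ fromℤ k ℚ.- b ℚ.+ a
  increment≡carry {acc} {c} q k a b acc≡ acc+c≡ = begin
    c                                          ≡⟨ solve 2 (λ A C → C := (A :+ C) :- A) refl acc c ⟩
    (acc ℚ.+ c) ℚ.- acc                        ≡⟨ cong₂ ℚ._-_ acc+c≡ acc≡ ⟩
    (fromℤ (q ℤ.+ k) ℚ.- b) ℚ.- (fromℤ q ℚ.- a) ≡⟨ cong (λ w → (w ℚ.- b) ℚ.- (fromℤ q ℚ.- a)) (fromℤ-+ q k) ⟩
    (fromℤ q ℚ.+ fromℤ k ℚ.- b) ℚ.- (fromℤ q ℚ.- a)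
      ≡⟨ solve 4 (λ Q K A B → (Q :+ K :- B) :- (Q :- A) := K :- B :+ A) refl (fromℤ q) (fromℤ k) a b ⟩
    fromℤ k ℚ.- b ℚ.+ a                        ∎

  InParFrom-REM⁻¹-from : ∀ {m} {acc} q zp tp (t z : Vec ℕ m) → zp ℕ.< suc tp →
    acc ≡ fromℤ q ℚ.- fraction zp (suc tp) → Pointwise ℕ._<_ z t → InParFrom acc t (REM⁻¹-from q zp (suc tp) t z)
  InParFrom-REM⁻¹-from q zp tp [] [] _ _ [] = tt
  InParFrom-REM⁻¹-from q zp tp (zero ∷ ts) (z ∷ zs) _ _ (() ∷ _)
  InParFrom-REM⁻¹-from {acc = acc} q zp tp (suc t ∷ ts) (z ∷ zs) zp<tp acc≡ (z<t ∷ zs<ts) =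
    c , c∈ , x≡ , InParFrom-REM⁻¹-from q′ z t ts zs z<t acc+c≡ zs<ts
    where
    k = + ascStep (suc tp) (suc t) zp z
    q′ = q ℤ.+ k
    T = fromℤ (+ suc t)
    b = fraction z (suc t)
    c = (fromℤ q′ ℚ.- b) ℚ.- acc
    acc+c≡ : acc ℚ.+ c ≡ fromℤ q′ ℚ.- b
    acc+c≡ = solve 2 (λ A N → A :+ (N :- A) := N) refl acc (fromℤ q′ ℚ.- b)
    c∈ : InUnit c
    c∈ = subst InUnit (sym (increment≡carry q k (fraction zp (suc tp)) b acc≡ acc+c≡)) (ascStep-inUnit zp<tp z<t)
    x≡ : fromℤ (q′ ℤ.* + suc t ℤ.- + z) ≡ (acc ℚ.+ c) ℚ.* T
    x≡ = begin
      fromℤ (q′ ℤ.* + suc t ℤ.- + z)     ≡⟨ fromℤ-*-minus q′ (+ suc t) (+ z) ⟩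
      fromℤ q′ ℚ.* T ℚ.- fromℤ (+ z)     ≡⟨ cong (λ w → fromℤ q′ ℚ.* T ℚ.- w) (sym (fraction-*-denominator z t)) ⟩
      fromℤ q′ ℚ.* T ℚ.- b ℚ.* T         ≡⟨ solve 3 (λ N B T → N :* T :- B :* T := (N :- B) :* T) refl (fromℤ q′) b T ⟩
      (fromℤ q′ ℚ.- b) ℚ.* T             ≡⟨ cong (ℚ._* T) (sym acc+c≡) ⟩
      (acc ℚ.+ c) ℚ.* T                  ∎

InParFrom⇒≡REM⁻¹-from : ∀ {m} {acc} q zp tp (t : Vec ℕ m) (x : Vec ℤ m) → zp ℕ.< suc tp →
  acc ≡ fromℤ q ℚ.- fraction zp (suc tp) → All (1 ≤_) t → InParFrom acc t x →
  x ≡ REM⁻¹-from q zp (suc tp) t (REM t x)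
InParFrom⇒≡REM⁻¹-from q zp tp [] [] _ _ [] _ = refl
InParFrom⇒≡REM⁻¹-from {acc = acc} q zp tp (suc t ∷ ts) (x ∷ xs) zp<tp acc≡ (_ ∷ ts-pos) (c , c∈ , x≡ , rest) =
  cong₂ _∷_ (trans (x≡quot*t-negRem x t) (cong (λ k → k ℤ.* + suc t ℤ.- + z) q′≡))
            (trans (InParFrom⇒≡REM⁻¹-from q′ z t ts xs z<t acc+c≡ ts-pos rest)
                   (cong (λ k → REM⁻¹-from k z (suc t) ts (REM ts xs)) q′≡))
  where
  z = negRem x (suc t)
  z<t = negRem< x t
  q′ = quot x (suc t)
  q′≡q+[q′-q] : q′ ≡ q ℤ.+ (q′ ℤ.- q)
  q′≡q+[q′-q] = solve 2 (λ Q′ Q → Q′ := Q :+ (Q′ :- Q)) refl q′ q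
    where open ℤSolver.+-*-Solver
  acc+c≡ : acc ℚ.+ c ≡ fromℤ q′ ℚ.- fraction z (suc t)
  acc+c≡ = *-denominator⇒-fraction (acc ℚ.+ c) (fromℤ q′) z t
    (trans (sym x≡) (trans (cong fromℤ (x≡quot*t-negRem x t)) (fromℤ-*-minus q′ (+ suc t) (+ z))))
  q′≡ : q′ ≡ q ℤ.+ + ascStep (suc tp) (suc t) zp z
  q′≡ = trans q′≡q+[q′-q] (cong (ℤ._+_ q) (carry≡ascStep zp<tp z<t (q′ ℤ.- q)
    (subst InUnit (increment≡carry q (q′ ℤ.- q) (fraction zp (suc tp)) (fraction z (suc t)) acc≡
      (trans acc+c≡ (cong (λ w → fromℤ w ℚ.- fraction z (suc t)) q′≡q+[q′-q]))) c∈)))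

InPar⇒≡REM⁻¹ : ∀ {m} (t : Vec ℕ m) (x : Vec ℤ m) → All (1 ≤_) t → InPar t x → x ≡ REM⁻¹ t (REM t x)
InPar⇒≡REM⁻¹ t x t-pos x∈ =
  InParFrom⇒≡REM⁻¹-from (+ 0) 0 0 t x (s≤s z≤n) refl t-pos (Equivalence.to (InPar⇔InParFrom0 t x) x∈)

InPar-REM⁻¹ : ∀ {m} (t z : Vec ℕ m) → Pointwise ℕ._<_ z t → InPar t (REM⁻¹ t z)
InPar-REM⁻¹ t z z<t =
  Equivalence.from (InPar⇔InParFrom0 t (REM⁻¹ t z)) (InParFrom-REM⁻¹-from (+ 0) 0 0 t z (s≤s z≤n) refl z<t)

REM-REM⁻¹ : ∀ {m} (t z : Vec ℕ m) → Pointwise ℕ._<_ z t → REM t (REM⁻¹ t z) ≡ z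
REM-REM⁻¹ = REM-REM⁻¹-from (+ 0) 0 1

REM-< : ∀ {m} (t : Vec ℕ m) (x : Vec ℤ m) → All (1 ≤_) t → Pointwise ℕ._<_ (REM t x) t
REM-< [] [] [] = []
REM-< (suc t ∷ ts) (x ∷ xs) (_ ∷ ts-pos) = negRem< x t ∷ REM-< ts xs ts-pos

REM-∷ʳ1 : ∀ {m} (t : Vec ℕ m) (x : Vec ℤ (suc m)) → REM (t ∷ʳ 1) x ≡ REM t (init x) ∷ʳ 0
REM-∷ʳ1 [] (x ∷ []) = cong (_∷ []) (ℕP.n<1⇒n≡0 (negRem< x 0))
REM-∷ʳ1 (t ∷ ts) (x ∷ xs) = cong (negRem x t ∷_) (REM-∷ʳ1 ts xs)

asc-∷ʳ : ∀ {m} (t z : Vec ℕ (suc m)) → asc (t ∷ʳ 1) (z ∷ʳ 0) ≡ asc t z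
asc-∷ʳ (t ∷ []) (z ∷ []) = refl
asc-∷ʳ (t ∷ t′ ∷ ts) (z ∷ z′ ∷ zs) = cong (ascStep t t′ z z′ ℕ.+_) (asc-∷ʳ (t′ ∷ ts) (z′ ∷ zs))

init-∷ʳ-last : ∀ {A : Set} {m} (v : Vec A (suc m)) → init v ∷ʳ last v ≡ v
init-∷ʳ-last v with initLast v
... | _ , _ , refl = refl

All-∷ʳ : ∀ {A : Set} {P : A → Set} {m} {xs : Vec A m} {x} → All P xs → P x → All P (xs ∷ʳ x)
All-∷ʳ [] px = px ∷ []
All-∷ʳ (py ∷ pxs) px = py ∷ All-∷ʳ pxs px

Pointwise-∷ʳ : ∀ {R : ℕ → ℕ → Set} {m} {xs ys : Vec ℕ m} {x y} → Pointwise R xs ys → R x y → Pointwise R (xs ∷ʳ x) (ys ∷ʳ y)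
Pointwise-∷ʳ [] r = r ∷ []
Pointwise-∷ʳ (r′ ∷ rs) r = r′ ∷ Pointwise-∷ʳ rs r

InΨ⇒< : ∀ {m} {s r : Vec ℕ m} → All (1 ≤_) s → InΨ s r → Pointwise ℕ._<_ r s
InΨ⇒< {s = []} {[]} [] _ = []
InΨ⇒< {s = zero ∷ _} {_ ∷ _} (() ∷ _) _
InΨ⇒< {s = suc _ ∷ _} {_ ∷ _} (_ ∷ s-pos) ψ = s≤s (ψ Fin.zero) ∷ InΨ⇒< s-pos (ψ ∘ Fin.suc)

<⇒InΨ : ∀ {m} {s r : Vec ℕ m} → Pointwise ℕ._<_ r s → InΨ s r
<⇒InΨ (s≤s r<s ∷ _) Fin.zero = r<s
<⇒InΨ (_ ∷ rs<ss) (Fin.suc k) = <⇒InΨ rs<ss k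

vecsBelow : ∀ {m} → Vec ℕ m → List (Vec ℕ m)
vecsBelow [] = List.[ [] ]
vecsBelow (t ∷ ts) = List.cartesianProductWith _∷_ (List.upTo t) (vecsBelow ts)

∈-vecsBelow⇔ : ∀ {m} (t z : Vec ℕ m) → z ∈ vecsBelow t ⇔ Pointwise ℕ._<_ z t
∈-vecsBelow⇔ t z = mk⇔ (to t z) (from t z)
  where
  to : ∀ {m} (t z : Vec ℕ m) → z ∈ vecsBelow t → Pointwise ℕ._<_ z t
  to [] [] _ = []
  to (t ∷ ts) (z ∷ zs) z∈ with ∈-cartesianProductWith⁻ _∷_ (List.upTo t) (vecsBelow ts) z∈
  ... | _ , _ , a∈ , v∈ , refl = ∈-upTo⁻ a∈ ∷ to ts zs v∈
  from : ∀ {m} (t z : Vec ℕ m) → Pointwise ℕ._<_ z t → z ∈ vecsBelow t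
  from [] [] [] = here refl
  from (t ∷ ts) (z ∷ zs) (z<t ∷ zs<ts) = ∈-cartesianProductWith⁺ _∷_ (∈-upTo⁺ z<t) (from ts zs zs<ts)

vecsBelow-unique : ∀ {m} (t : Vec ℕ m) → Unique (vecsBelow t)
vecsBelow-unique [] = ListAll.[] AllPairs.∷ AllPairs.[]
vecsBelow-unique (t ∷ ts) = UniqueP.cartesianProductWith⁺ _∷_ VecP.∷-injective (UniqueP.upTo⁺ t) (vecsBelow-unique ts)

HasSize-filter : ∀ {A : Set} {P Q : A → Set} (xs : List A) → Unique xs → (∀ a → a ∈ xs ⇔ P a) →
  (Q? : Decidable Q) → (λ a → P a × Q a) HasSize length (filter Q? xs)
HasSize-filter xs xs-unique ∈xs⇔P Q? =
  filter Q? xs , UniqueP.filter⁺ Q? xs-unique , refl , λ a → mk⇔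
    (λ a∈ → let a∈xs , qa = ∈-filter⁻ Q? {xs = xs} a∈ in Equivalence.to (∈xs⇔P a) a∈xs , qa)
    (λ (pa , qa) → ∈-filter⁺ Q? (Equivalence.from (∈xs⇔P a) pa) qa)

HasSize-transport : ∀ {A B : Set} {P : A → Set} {Q : B → Set} {k} (f : A → B) (g : B → A) →
  (∀ a → P a → Q (f a)) → (∀ b → Q b → P (g b)) →
  (∀ a → P a → g (f a) ≡ a) → (∀ b → Q b → f (g b) ≡ b) →
  P HasSize k → Q HasSize k
HasSize-transport {P = P} {Q} f g P⇒Q Q⇒P gf≡ fg≡ (xs , xs-unique , refl , ∈xs⇔P) =
  List.map f xs , fxs-unique , ListP.length-map f xs , λ b → mk⇔ (to b) (from b)
  where
  P-∈xs : ∀ {a} → a ∈ xs → P a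
  P-∈xs {a} a∈ = Equivalence.to (∈xs⇔P a) a∈
  fxs-unique : Unique (List.map f xs)
  fxs-unique = UniqueP.map⁻ {f = g} (subst Unique
    (sym (trans (sym (ListP.map-∘ xs)) (ListP.map-id-local (ListAll.tabulate (λ a∈ → gf≡ _ (P-∈xs a∈))))))
    xs-unique)
  to : ∀ b → b ∈ List.map f xs → Q b
  to b b∈ with ∈-map⁻ f b∈
  ... | a , a∈ , refl = P⇒Q a (P-∈xs a∈)
  from : ∀ b → Q b → b ∈ List.map f xs
  from b qb = subst (_∈ List.map f xs) (fg≡ b qb) (∈-map⁺ f (Equivalence.from (∈xs⇔P (g b)) (Q⇒P b qb)))

head≡0 : ∀ {m} {s r : Vec ℕ (suc m)} → head s ≡ 1 → Pointwise ℕ._<_ r s → head r ≡ 0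
head≡0 {s = _ ∷ _} {_ ∷ _} refl (s≤s z≤n ∷ _) = refl

asc-1∷-0∷ : ∀ {m} (t z : Vec ℕ (suc m)) → head z ≡ 0 → asc (1 ∷ t) (0 ∷ z) ≡ asc t z
asc-1∷-0∷ (t ∷ ts) (.0 ∷ zs) refl = refl

-- The map ρ = π ∘ REM_{s*} and its inverse

module Star {n} (s : Vec ℕ (suc n)) (s-pos : All (1 ≤_) s) (s₁≡1 : head s ≡ 1) where

  s*-pos : All (1 ≤_) (s ∷ʳ 1)
  s*-pos = All-∷ʳ s-pos (s≤s z≤n)

  ρ : Vec ℤ (suc (suc n)) → Vec ℕ (suc n)
  ρ x = init (REM (s ∷ʳ 1) x)

  ρ≡REM-init : ∀ x → ρ x ≡ REM s (init x)
  ρ≡REM-init x = trans (cong init (REM-∷ʳ1 s x)) (VecP.init-∷ʳ 0 (REM s (init x)))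

  REM≡ρ∷ʳ0 : ∀ x → REM (s ∷ʳ 1) x ≡ ρ x ∷ʳ 0
  REM≡ρ∷ʳ0 x = trans (REM-∷ʳ1 s x) (cong (_∷ʳ 0) (sym (ρ≡REM-init x)))

  ρ-< : ∀ x → Pointwise ℕ._<_ (ρ x) s
  ρ-< x = subst (λ r → Pointwise ℕ._<_ r s) (sym (ρ≡REM-init x)) (REM-< s (init x) s-pos)

  asc-REM : ∀ x → asc (s ∷ʳ 1) (REM (s ∷ʳ 1) x) ≡ asc s (ρ x)
  asc-REM x = trans (cong (asc (s ∷ʳ 1)) (REM≡ρ∷ʳ0 x)) (asc-∷ʳ s (ρ x))

  ρ⁻¹ : Vec ℕ (suc n) → Vec ℤ (suc (suc n))
  ρ⁻¹ r = REM⁻¹ (s ∷ʳ 1) (r ∷ʳ 0)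

  ρ⁻¹-ρ : ∀ x → InPar (s ∷ʳ 1) x → ρ⁻¹ (ρ x) ≡ x
  ρ⁻¹-ρ x x∈ = sym (trans (InPar⇒≡REM⁻¹ (s ∷ʳ 1) x s*-pos x∈) (cong (REM⁻¹ (s ∷ʳ 1)) (REM≡ρ∷ʳ0 x)))

  REM-ρ⁻¹ : ∀ r → Pointwise ℕ._<_ r s → REM (s ∷ʳ 1) (ρ⁻¹ r) ≡ r ∷ʳ 0
  REM-ρ⁻¹ r r<s = REM-REM⁻¹ (s ∷ʳ 1) (r ∷ʳ 0) (Pointwise-∷ʳ r<s (s≤s z≤n))

  ρ-ρ⁻¹ : ∀ r → Pointwise ℕ._<_ r s → ρ (ρ⁻¹ r) ≡ r
  ρ-ρ⁻¹ r r<s = trans (cong init (REM-ρ⁻¹ r r<s)) (VecP.init-∷ʳ 0 r)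

  InPar-ρ⁻¹ : ∀ r → Pointwise ℕ._<_ r s → InPar (s ∷ʳ 1) (ρ⁻¹ r)
  InPar-ρ⁻¹ r r<s = InPar-REM⁻¹ (s ∷ʳ 1) (r ∷ʳ 0) (Pointwise-∷ʳ r<s (s≤s z≤n))

  -- The last coordinate of a point is its running quotient, which counts the ascents.
  last-ρ⁻¹ : ∀ r → Pointwise ℕ._<_ r s → last (ρ⁻¹ r) ≡ + asc s r
  last-ρ⁻¹ r r<s = begin
    last (ρ⁻¹ r)
      ≡⟨ last-REM⁻¹-from (+ 0) 0 1 (s ∷ʳ 1) (r ∷ʳ 0) ⟩
    (+ 0 ℤ.+ + asc (1 ∷ (s ∷ʳ 1)) (0 ∷ (r ∷ʳ 0))) ℤ.* + last (s ∷ʳ 1) ℤ.- + last (r ∷ʳ 0)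
      ≡⟨ cong₂ (λ u v → (+ 0 ℤ.+ + asc (1 ∷ (s ∷ʳ 1)) (0 ∷ (r ∷ʳ 0))) ℤ.* + u ℤ.- + v) (VecP.last-∷ʳ 1 s) (VecP.last-∷ʳ 0 r) ⟩
    (+ 0 ℤ.+ + asc (1 ∷ (s ∷ʳ 1)) (0 ∷ (r ∷ʳ 0))) ℤ.* + 1 ℤ.- + 0
      ≡⟨ trans (ℤP.+-identityʳ _) (trans (ℤP.*-identityʳ _) (ℤP.+-identityˡ _)) ⟩
    + asc (1 ∷ (s ∷ʳ 1)) (0 ∷ (r ∷ʳ 0))
      ≡⟨ cong +_ (trans (asc-∷ʳ (1 ∷ s) (0 ∷ r)) (asc-1∷-0∷ s r (head≡0 s₁≡1 r<s))) ⟩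
    + asc s r ∎
    where open ≡-Reasoning

  last-InPar : ∀ x → InPar (s ∷ʳ 1) x → last x ≡ + asc s (ρ x)
  last-InPar x x∈ = trans (cong last (sym (ρ⁻¹-ρ x x∈))) (last-ρ⁻¹ (ρ x) (ρ-< x))

  ρ-injective : ∀ x y → InPar (s ∷ʳ 1) x → InPar (s ∷ʳ 1) y → ρ x ≡ ρ y → x ≡ y
  ρ-injective x y x∈ y∈ ρx≡ρy = trans (sym (ρ⁻¹-ρ x x∈)) (trans (cong ρ⁻¹ ρx≡ρy) (ρ⁻¹-ρ y y∈))

  ρ-surjective : ∀ r → InΨ s r → ∃[ x ] (InPar (s ∷ʳ 1) x × ρ x ≡ r)
  ρ-surjective r ψ = ρ⁻¹ r , InPar-ρ⁻¹ r (InΨ⇒< s-pos ψ) , ρ-ρ⁻¹ r (InΨ⇒< s-pos ψ)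

  InΨ⇔< : ∀ r → InΨ s r ⇔ Pointwise ℕ._<_ r s
  InΨ⇔< r = mk⇔ (InΨ⇒< s-pos) <⇒InΨ

  InΨ-ρ : ∀ x → InΨ s (ρ x)
  InΨ-ρ x = <⇒InΨ (ρ-< x)

  init-∷ʳ0 : ∀ (r : Vec ℕ (suc (suc n))) → last r ≤ 0 → init r ∷ʳ 0 ≡ r
  init-∷ʳ0 r last≤0 = trans (cong (init r ∷ʳ_) (sym (ℕP.n≤0⇒n≡0 last≤0))) (init-∷ʳ-last r)

  L : ℕ → Vec ℤ (suc (suc n)) → Set
  L i x = InPar (s ∷ʳ 1) x × last x ≡ + i

  S₁ S₂ S₃ : ℕ → Vec ℤ (suc (suc n)) → Set
  S₁ i x = InPar (s ∷ʳ 1) x × asc (s ∷ʳ 1) (REM (s ∷ʳ 1) x) ≡ i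
  S₂ i x = ∃[ r ] ((InΨ s (init r) × last r ≤ 0) × asc (s ∷ʳ 1) r ≡ i × InPar (s ∷ʳ 1) x × REM (s ∷ʳ 1) x ≡ r)
  S₃ i x = ∃[ r ] (InΨ s r × asc s r ≡ i × InPar (s ∷ʳ 1) x × REM (s ∷ʳ 1) x ≡ r ∷ʳ 0)

  R₂ : ℕ → Vec ℕ (suc (suc n)) → Set
  R₂ i r = (InΨ s (init r) × last r ≤ 0) × asc (s ∷ʳ 1) r ≡ i

  R₃ : ℕ → Vec ℕ (suc n) → Set
  R₃ i r = InΨ s r × asc s r ≡ i

  L⇔asc-ρ : ∀ i x → InPar (s ∷ʳ 1) x → L i x ⇔ asc s (ρ x) ≡ i
  L⇔asc-ρ i x x∈ = mk⇔ (λ (_ , last≡) → ℤP.+-injective (trans (sym (last-InPar x x∈)) last≡))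
                       (λ asc≡ → x∈ , trans (last-InPar x x∈) (cong +_ asc≡))

  L⇔S₁ : ∀ i x → L i x ⇔ S₁ i x
  L⇔S₁ i x = mk⇔ (λ (x∈ , last≡) → x∈ , trans (asc-REM x) (Equivalence.to (L⇔asc-ρ i x x∈) (x∈ , last≡)))
                 (λ (x∈ , asc≡) → Equivalence.from (L⇔asc-ρ i x x∈) (trans (sym (asc-REM x)) asc≡))

  S₁⇔S₂ : ∀ i x → S₁ i x ⇔ S₂ i x
  S₁⇔S₂ i x = mk⇔
    (λ (x∈ , asc≡) → REM (s ∷ʳ 1) x ,
       ((InΨ-ρ x , ℕP.≤-reflexive (trans (cong last (REM≡ρ∷ʳ0 x)) (VecP.last-∷ʳ 0 (ρ x)))) , asc≡ , x∈ , refl))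
    (λ { (_ , _ , asc≡ , x∈ , refl) → x∈ , asc≡ })

  S₁⇔S₃ : ∀ i x → S₁ i x ⇔ S₃ i x
  S₁⇔S₃ i x = mk⇔
    (λ (x∈ , asc≡) → ρ x , InΨ-ρ x , trans (sym (asc-REM x)) asc≡ , x∈ , REM≡ρ∷ʳ0 x)
    (λ (r , _ , asc≡ , x∈ , REM≡) → x∈ , trans (cong (asc (s ∷ʳ 1)) REM≡) (trans (asc-∷ʳ s r) asc≡))

  #ascents≡ : ℕ → ℕ
  #ascents≡ i = length (filter (λ r → asc s r ℕP.≟ i) (vecsBelow s))

  R₃-size : ∀ i → R₃ i HasSize #ascents≡ i
  R₃-size i = HasSize-filter (vecsBelow s) (vecsBelow-unique s)
    (λ r → ⇔.trans (∈-vecsBelow⇔ s r) (⇔.sym (InΨ⇔< r))) (λ r → asc s r ℕP.≟ i)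

  R₂-size : ∀ i → R₂ i HasSize #ascents≡ i
  R₂-size i = HasSize-transport (_∷ʳ 0) init
    (λ r (ψ , asc≡) → (subst (InΨ s) (sym (VecP.init-∷ʳ 0 r)) ψ , ℕP.≤-reflexive (VecP.last-∷ʳ 0 r)) ,
                      trans (asc-∷ʳ s r) asc≡)
    (λ r ((ψ , last≤0) , asc≡) → ψ ,
       trans (sym (asc-∷ʳ s (init r))) (trans (cong (asc (s ∷ʳ 1)) (init-∷ʳ0 r last≤0)) asc≡))
    (λ r _ → VecP.init-∷ʳ 0 r)
    (λ r ((_ , last≤0) , _) → init-∷ʳ0 r last≤0)
    (R₃-size i)

  L-size : ∀ i → L i HasSize #ascents≡ i
  L-size i = HasSize-transport ρ⁻¹ ρ
    (λ r (ψ , asc≡) → InPar-ρ⁻¹ r (InΨ⇒< s-pos ψ) , trans (last-ρ⁻¹ r (InΨ⇒< s-pos ψ)) (cong +_ asc≡))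
    (λ x (x∈ , last≡) → InΨ-ρ x , Equivalence.to (L⇔asc-ρ i x x∈) (x∈ , last≡))
    (λ r (ψ , _) → ρ-ρ⁻¹ r (InΨ⇒< s-pos ψ))
    (λ x (x∈ , _) → ρ⁻¹-ρ x x∈)
    (R₃-size i)

corollary6p2 : (n : ℕ) (s : Vec ℕ (suc n)) → ((k : Fin (suc n)) → 1 ≤ lookup s k) → head s ≡ 1 →
  let sStar = s ∷ʳ 1
      L = λ (i : ℕ) (x : Vec ℤ (suc (suc n))) → InPar sStar x × last x ≡ + i
      S₁ = λ (i : ℕ) (x : Vec ℤ (suc (suc n))) → InPar sStar x × asc sStar (REM sStar x) ≡ i
      S₂ = λ (i : ℕ) (x : Vec ℤ (suc (suc n))) → ∃[ r ] ((InΨ s (init r) × last r ≤ 0) × asc sStar r ≡ i × InPar sStar x × REM sStar x ≡ r)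
      S₃ = λ (i : ℕ) (x : Vec ℤ (suc (suc n))) → ∃[ r ] (InΨ s r × asc s r ≡ i × InPar sStar x × REM sStar x ≡ r ∷ʳ 0)
      R₂ = λ (i : ℕ) (r : Vec ℕ (suc (suc n))) → (InΨ s (init r) × last r ≤ 0) × asc sStar r ≡ i
      R₃ = λ (i : ℕ) (r : Vec ℕ (suc n)) → InΨ s r × asc s r ≡ i
  in ((i : ℕ) (x : Vec ℤ (suc (suc n))) → (L i x ⇔ S₁ i x) × (S₁ i x ⇔ S₂ i x) × (S₂ i x ⇔ S₃ i x))
     × ((i : ℕ) → ∃[ k ] ((L i HasSize k) × (R₂ i HasSize k) × (R₃ i HasSize k)))
     × (((x : Vec ℤ (suc (suc n))) → InPar sStar x → InΨ s (init (REM sStar x)))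
        × ((x y : Vec ℤ (suc (suc n))) → InPar sStar x → InPar sStar y → init (REM sStar x) ≡ init (REM sStar y) → x ≡ y)
        × ((r : Vec ℕ (suc n)) → InΨ s r → ∃[ x ] (InPar sStar x × init (REM sStar x) ≡ r))
        × ((i : ℕ) (x : Vec ℤ (suc (suc n))) → InPar sStar x → (L i x ⇔ asc s (init (REM sStar x)) ≡ i)))
corollary6p2 n s s-pos s₁≡1 =
  (λ i x → L⇔S₁ i x , S₁⇔S₂ i x , ⇔.trans (⇔.sym (S₁⇔S₂ i x)) (S₁⇔S₃ i x)) ,
  (λ i → #ascents≡ i , L-size i , R₂-size i , R₃-size i) ,
  (λ x _ → InΨ-ρ x) , ρ-injective , ρ-surjective , L⇔asc-ρ
  where open Star s (AllP.lookup⁻ s-pos) s₁≡1
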